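{- Let $m,n\in\mathbb{N}$. Let $\mathfrak{c}_1=(C_1,\le_1)$ be a chain with $C_1=\{a_1,\dots,a_m\}$, $a_i\le_1 a_j \iff i\le j$, and let $\mathfrak{c}_2=(C_2,\le_2)$ be a chain with $C_2=\{b_1,\dots,b_n\}$ disjoint from $C_1$, $b_i\le_2 b_j\iff i\le j$. Let $\mathfrak{C}_{m,n}^{\bullet}$ denote the set of proper mergings of $\mathfrak{c}_1$ and $\mathfrak{c}_2$. Then \[ \left\lvert\mathfrak{C}_{m,n}^{\bullet}\right\rvert=\frac{1}{n+m+1}\binom{n+m+1}{m+1}\binom{n+m+1}{m}. \]
   Context: A quasi-order is a reflexive, transitive binary relation. Let $(P,\leftarrow_P)$ and $(Q,\leftarrow_Q)$ be disjoint quasi-ordered sets. For relations $R\subseteq P\times Q$ and $S\subseteq Q\times P$, define the relation $\leftarrow_{R,S}$ on $P\cup Q$ by: $p\leftarrow_{R,S} q$ iff $p\leftarrow_P q$ or $p\leftarrow_Q q$ or $(p,q)\in R$ or $(p,q)\in S$. The pair $(R,S)$ is called a merging of $P$ and $Q$ if $\leftarrow_{R,S}$ is a quasi-order on $P\cup Q$; it is called proper if moreover $R\cap S^{ -1}=\emptyset$. Mergings are counted as pairs $(R,S)$ of relations. -}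

module Defs where

open import Data.Nat using (ℕ; suc; _≤_)
open import Data.Fin using (Fin; toℕ)
open import Data.Bool using (Bool; true)
open import Data.Vec using (Vec; lookup)
open import Data.Sum using (_⊎_; inj₁; inj₂)
open import Data.Product using (_×_)
open import Relation.Binary.PropositionalEquality using (_≡_)
open import Relation.Binary.Definitions using (Reflexive; Transitive)
open import Relation.Nullary using (¬_)

-- A binary relation between Fin m and Fin n, given as an m × n Boolean matrix:
-- (i , j) ∈ R  iff  lookup (lookup R i) j ≡ true.
BRel : ℕ → ℕ → Set
BRel m n = Vec (Vec Bool n) m

_∋⟨_,_⟩ : ∀ {m n} → BRel m n → Fin m → Fin n → Set
R ∋⟨ i , j ⟩ = lookup (lookup R i) j ≡ true

-- The chain c₁ = {a_1 < ... < a_m} is Fin m with a_i ≤₁ a_j iff i ≤ j,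
-- the chain c₂ = {b_1 < ... < b_n} is Fin n likewise; their disjoint union
-- is Fin m ⊎ Fin n.
merged : ∀ {m n} → BRel m n → BRel n m → Fin m ⊎ Fin n → Fin m ⊎ Fin n → Set
merged R S (inj₁ i) (inj₁ j) = toℕ i ≤ toℕ j
merged R S (inj₂ i) (inj₂ j) = toℕ i ≤ toℕ j
merged R S (inj₁ i) (inj₂ j) = R ∋⟨ i , j ⟩
merged R S (inj₂ j) (inj₁ i) = S ∋⟨ j , i ⟩

IsQuasiOrder : ∀ {A : Set} → (A → A → Set) → Set
IsQuasiOrder _∼_ = Reflexive _∼_ × Transitive _∼_

IsMerging : ∀ {m n} → BRel m n → BRel n m → Set
IsMerging R S = IsQuasiOrder (merged R S)

IsProperMerging : ∀ {m n} → BRel m n → BRel n m → Set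
IsProperMerging {m} {n} R S =
  IsMerging R S × ((i : Fin m) (j : Fin n) → ¬ (R ∋⟨ i , j ⟩ × S ∋⟨ j , i ⟩))

-- Transitivity forces a proper merging of a₁ < ⋯ < aₘ and b₁ < ⋯ < bₙ to be cut out by
-- thresholds: aᵢ ← bⱼ exactly when i < ℓⱼ and bⱼ ← aᵢ exactly when fⱼ ≤ i, where ℓ and f
-- are weakly increasing, and properness is ℓ ≤ f ≤ m.  Reflected as pⱼ = m − ℓⱼ and
-- qⱼ = m − fⱼ, these are two weakly decreasing sequences q ≤ p bounded by m, i.e. two
-- non-crossing lattice paths.  Counting them by their first entries yields the
-- Lindström–Gessel–Viennot determinant (n+m C n)² − (n+m C n−1)·(n+m C n+1), and the
-- absorption identity k·(N C k) = N·(N−1 C k−1) turns it into the Narayana number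
-- (n+m+1 C m+1)·(n+m+1 C m)/(n+m+1).

module Submission where

open import Data.Bool using (Bool; true; false)
open import Data.Bool.Properties using (T-≡; ⇔→≡)
open import Data.Fin using (Fin; zero; suc; toℕ; fromℕ<)
open import Data.Fin.Properties using (toℕ-fromℕ<)
open import Data.List using (List; [_]; _++_; map; length)
open import Data.List.Membership.Propositional using (_∈_)
open import Data.List.Membership.Propositional.Properties
  using (∈-map⁺; ∈-map⁻; ∈-++⁺ˡ; ∈-++⁺ʳ; ∈-++⁻)
open import Data.List.Properties using (length-++; length-map; map-∘; map-id-local)
import Data.List.Relation.Unary.All as All
open import Data.List.Relation.Unary.AllPairs using ([]; _∷_)
open import Data.List.Relation.Unary.Any using (here)
open import Data.List.Relation.Unary.Unique.Propositional using (Unique)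
import Data.List.Relation.Unary.Unique.Propositional.Properties as Unique
open import Data.Nat
open import Data.Nat.Combinatorics using (_C_; nCn≡1; nCk+nC[k+1]≡[n+1]C[k+1])
open import Data.Nat.DivMod using (m*n/n≡m)
open import Data.Nat.Properties
open import Algebra.Properties.CommutativeSemigroup +-commutativeSemigroup using (interchange)
open import Data.Nat.Tactic.RingSolver using (solve-∀)
open import Data.Product using (Σ; _×_; _,_; proj₁; proj₂; map₁)
open import Data.Sum as Sum using (_⊎_; inj₁; inj₂)
open import Data.Vec as Vec using (Vec; []; _∷_; head; lookup; tabulate)
open import Data.Vec.Properties using (∷-injectiveʳ; lookup∘tabulate; lookup-map; tabulate-cong)
open import Data.Vec.Relation.Binary.Pointwise.Extensional using (ext; Pointwise-≡⇒≡)
open import Function using (_∘_)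
open import Function.Bundles using (_⇔_; mk⇔; Equivalence)
import Function.Properties.Equivalence as ⇔
open import Relation.Binary.Definitions using (Transitive)
open import Relation.Binary.PropositionalEquality
  using (_≡_; refl; sym; trans; cong; cong₂; subst; subst₂; module ≡-Reasoning)
open import Relation.Nullary using (¬_)

open import Defs

open Equivalence using (to; from)

-- Lattice path counts

-- Defined by Pascal's rule, so that the recurrences of the enumeration below hold by computation.
paths : ℕ → ℕ → ℕ
paths zero    b       = 1
paths (suc a) zero    = 1
paths (suc a) (suc b) = paths (suc a) b + paths a (suc b)

paths≡C : ∀ a b → paths a b ≡ (a + b) C b
paths≡C zero    b       = sym (nCn≡1 b)
paths≡C (suc a) zero    = refl
paths≡C (suc a) (suc b) = begin
  paths (suc a) b + paths a (suc b)      ≡⟨ cong₂ _+_ (paths≡C (suc a) b) (paths≡C a (suc b)) ⟩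
  (suc a + b) C b + (a + suc b) C suc b  ≡⟨ cong (λ k → k C b + (a + suc b) C suc b) (+-suc a b) ⟨
  (a + suc b) C b + (a + suc b) C suc b  ≡⟨ nCk+nC[k+1]≡[n+1]C[k+1] (a + suc b) b ⟩
  suc (a + suc b) C suc b                ∎
  where open ≡-Reasoning

-- paths⁻ a b = (a + b) C (a ∸ 1) for a > 0 and paths⁺ a b = (a + b) C (a + 1) are the
-- increments of paths in b and in a (paths-sucʳ, paths-sucˡ); they count the paths to the
-- swapped endpoints in the Lindström–Gessel–Viennot determinant.
paths⁻ : ℕ → ℕ → ℕ
paths⁻ zero    b = 0
paths⁻ (suc a) b = paths a (suc b)

paths⁺ : ℕ → ℕ → ℕ
paths⁺ a zero    = 0
paths⁺ a (suc b) = paths (suc a) b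

paths-zeroʳ : ∀ a → paths a 0 ≡ 1
paths-zeroʳ zero    = refl
paths-zeroʳ (suc a) = refl

paths-sucʳ : ∀ a b → paths a (suc b) ≡ paths a b + paths⁻ a b
paths-sucʳ zero    b = refl
paths-sucʳ (suc a) b = refl

paths-sucˡ : ∀ a b → paths (suc a) b ≡ paths⁺ a b + paths a b
paths-sucˡ a zero    = sym (paths-zeroʳ a)
paths-sucˡ a (suc b) = refl

mutual
  paths-absorbˡ : ∀ a b → suc a * paths (suc a) b ≡ suc (a + b) * paths a b
  paths-absorbˡ a zero    = cong₂ (λ k p → suc k * p) (sym (+-identityʳ a)) (sym (paths-zeroʳ a))
  paths-absorbˡ a (suc b) = begin
    suc a * (P + Q)                      ≡⟨ *-distribˡ-+ (suc a) P Q ⟩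
    suc a * P + suc a * Q                ≡⟨ cong (_+ suc a * Q) (paths-absorbˡ a b) ⟩
    suc (a + b) * paths a b + suc a * Q  ≡⟨ cong (_+ suc a * Q) (paths-absorbʳ a b) ⟨
    suc b * Q + suc a * Q                ≡⟨ +-comm (suc b * Q) (suc a * Q) ⟩
    suc a * Q + suc b * Q                ≡⟨ *-distribʳ-+ Q (suc a) (suc b) ⟨
    suc (a + suc b) * Q                  ∎
    where
    open ≡-Reasoning
    P = paths (suc a) b
    Q = paths a (suc b)

  paths-absorbʳ : ∀ a b → suc b * paths a (suc b) ≡ suc (a + b) * paths a b
  paths-absorbʳ zero    b = refl
  paths-absorbʳ (suc a) b = begin
    suc b * (P + Q)                      ≡⟨ *-distribˡ-+ (suc b) P Q ⟩
    suc b * P + suc b * Q                ≡⟨ cong (suc b * P +_) (paths-absorbʳ a b) ⟩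
    suc b * P + suc (a + b) * paths a b  ≡⟨ cong (suc b * P +_) (paths-absorbˡ a b) ⟨
    suc b * P + suc a * P                ≡⟨ +-comm (suc b * P) (suc a * P) ⟩
    suc a * P + suc b * P                ≡⟨ *-distribʳ-+ P (suc a) (suc b) ⟨
    suc (a + suc b) * P                  ≡⟨ cong (λ k → suc k * P) (+-suc a b) ⟩
    suc (suc a + b) * P                  ∎
    where
    open ≡-Reasoning
    P = paths (suc a) b
    Q = paths a (suc b)

paths⁺-absorb : ∀ a b → suc a * paths⁺ a b ≡ b * paths a b
paths⁺-absorb a zero    = *-zeroʳ (suc a)
paths⁺-absorb a (suc b) = trans (paths-absorbˡ a b) (sym (paths-absorbʳ a b))

paths⁻-absorb : ∀ a b → suc b * paths⁻ a b ≡ a * paths a b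
paths⁻-absorb zero    b = *-zeroʳ (suc b)
paths⁻-absorb (suc a) b = trans (paths-absorbʳ a b) (sym (paths-absorbˡ a b))

-- L is the determinant paths k x · paths l y − paths⁺ l y · paths⁻ k x, stated without
-- truncated subtraction.
LGV : ℕ → ℕ → ℕ → ℕ → ℕ → Set
LGV L k l x y = L + paths⁺ l y * paths⁻ k x ≡ paths k x * paths l y

lgv-stepˡ : ∀ {L₁ L₂} k l x y → LGV L₁ (suc k) l x y → LGV L₂ k l (suc x) y →
            LGV (L₁ + L₂) (suc k) l (suc x) y
lgv-stepˡ {L₁} {L₂} k l x y e₁ e₂ = begin
  (L₁ + L₂) + w * paths⁻ (suc k) (suc x)     ≡⟨ cong (λ t → (L₁ + L₂) + w * t) (paths-sucʳ k (suc x)) ⟩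
  (L₁ + L₂) + w * (v₁ + v₂)                  ≡⟨ cong ((L₁ + L₂) +_) (*-distribˡ-+ w v₁ v₂) ⟩
  (L₁ + L₂) + (w * v₁ + w * v₂)              ≡⟨ interchange L₁ L₂ (w * v₁) (w * v₂) ⟩
  (L₁ + w * v₁) + (L₂ + w * v₂)              ≡⟨ cong₂ _+_ e₁ e₂ ⟩
  paths (suc k) x * d + paths k (suc x) * d  ≡⟨ *-distribʳ-+ d (paths (suc k) x) (paths k (suc x)) ⟨
  paths (suc k) (suc x) * d                  ∎
  where
  open ≡-Reasoning
  w  = paths⁺ l y
  d  = paths l y
  v₁ = paths⁻ (suc k) x
  v₂ = paths⁻ k (suc x)

lgv-stepʳ : ∀ {L₁ L₂} k l x y → LGV L₁ k (suc l) x y → LGV L₂ k l x (suc y) →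
            LGV (L₁ + L₂) k (suc l) x (suc y)
lgv-stepʳ {L₁} {L₂} k l x y e₁ e₂ = begin
  (L₁ + L₂) + paths⁺ (suc l) (suc y) * v     ≡⟨ cong (λ t → (L₁ + L₂) + t * v) (paths-sucˡ (suc l) y) ⟩
  (L₁ + L₂) + (w₁ + w₂) * v                  ≡⟨ cong ((L₁ + L₂) +_) (*-distribʳ-+ v w₁ w₂) ⟩
  (L₁ + L₂) + (w₁ * v + w₂ * v)              ≡⟨ interchange L₁ L₂ (w₁ * v) (w₂ * v) ⟩
  (L₁ + w₁ * v) + (L₂ + w₂ * v)              ≡⟨ cong₂ _+_ e₁ e₂ ⟩
  c * paths (suc l) y + c * paths l (suc y)  ≡⟨ *-distribˡ-+ c (paths (suc l) y) (paths l (suc y)) ⟨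
  c * paths (suc l) (suc y)                  ∎
  where
  open ≡-Reasoning
  v  = paths⁻ k x
  c  = paths k x
  w₁ = paths⁺ (suc l) y
  w₂ = paths⁺ l (suc y)

-- A lower sequence below an upper one bounded by x is bounded by x anyway, so the count
-- must not change when its own bound is raised from x to x + 1.
lgv-diagonal : ∀ {L} k x → LGV L k k x x → LGV L k k x (suc x)
lgv-diagonal {L} k x e = begin
  L + paths⁺ k (suc x) * a  ≡⟨ cong (λ t → L + t * a) (paths-sucˡ k x) ⟩
  L + (w + c) * a           ≡⟨ cong (L +_) (*-distribʳ-+ a w c) ⟩
  L + (w * a + c * a)       ≡⟨ +-assoc L (w * a) (c * a) ⟨
  (L + w * a) + c * a       ≡⟨ cong (_+ c * a) e ⟩
  c * c + c * a             ≡⟨ *-distribˡ-+ c c a ⟨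
  c * (c + a)               ≡⟨ cong (c *_) (paths-sucʳ k x) ⟨
  c * paths k (suc x)       ∎
  where
  open ≡-Reasoning
  c = paths k x
  a = paths⁻ k x
  w = paths⁺ k x

≤-suc-cases : ∀ {m n} → m ≤ suc n → m ≤ n ⊎ m ≡ suc n
≤-suc-cases = Sum.map₁ m<1+n⇒m≤n ∘ m≤n⇒m<n∨m≡n

lgv-clamp : ∀ {L} k x y → y ≤ suc x → LGV L k k x (y ⊓ x) → LGV L k k x y
lgv-clamp k x y y≤1+x e with ≤-suc-cases y≤1+x
... | inj₁ y≤x  = subst (LGV _ k k x) (m≤n⇒m⊓n≡m y≤x) e
... | inj₂ refl = lgv-diagonal k x (subst (LGV _ k k x) (m≥n⇒m⊓n≡n (n≤1+n x)) e)

-- Multiplying by (m + 1)(n + 1) turns the crossing term into (m·c)(n·c), by absorption.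
lgv-scaled : ∀ n m {T} → LGV T n n m m → suc m * (suc n * T) ≡ suc (n + m) * (paths n m * paths n m)
lgv-scaled n m {T} e = +-cancelʳ-≡ ((m * c) * (n * c)) _ _ (begin
  suc m * (suc n * T) + (m * c) * (n * c)
    ≡⟨ cong (suc m * (suc n * T) +_) (cong₂ _*_ (paths⁺-absorb n m) (paths⁻-absorb n m)) ⟨
  suc m * (suc n * T) + (suc n * w) * (suc m * v)
    ≡⟨ expand m n T w v ⟩
  suc m * (suc n * (T + w * v))
    ≡⟨ cong (λ t → suc m * (suc n * t)) e ⟩
  suc m * (suc n * (c * c))
    ≡⟨ split m n c ⟩
  suc (n + m) * (c * c) + (m * c) * (n * c)
    ∎)
  where
  open ≡-Reasoning
  c = paths n m
  w = paths⁺ n m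
  v = paths⁻ n m
  expand : ∀ m n T w v →
           suc m * (suc n * T) + (suc n * w) * (suc m * v) ≡ suc m * (suc n * (T + w * v))
  expand = solve-∀
  split : ∀ m n c → suc m * (suc n * (c * c)) ≡ suc (n + m) * (c * c) + (m * c) * (n * c)
  split = solve-∀

narayana-product : ∀ n m {T} → LGV T n n m m → paths n (suc m) * paths (suc n) m ≡ T * suc (n + m)
narayana-product n m {T} e = *-cancelˡ-≡ _ _ (suc n) (*-cancelˡ-≡ _ _ (suc m) (begin
  suc m * (suc n * (X * Y))  ≡⟨ interleave m n X Y ⟩
  (suc m * X) * (suc n * Y)  ≡⟨ cong₂ _*_ (paths-absorbʳ n m) (paths-absorbˡ n m) ⟩
  (N * c) * (N * c)          ≡⟨ regroup N c ⟩
  N * (N * (c * c))          ≡⟨ cong (N *_) (lgv-scaled n m e) ⟨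
  N * (suc m * (suc n * T))  ≡⟨ rotate m n N T ⟩
  suc m * (suc n * (T * N))  ∎))
  where
  open ≡-Reasoning
  N = suc (n + m)
  c = paths n m
  X = paths n (suc m)
  Y = paths (suc n) m
  interleave : ∀ m n X Y → suc m * (suc n * (X * Y)) ≡ (suc m * X) * (suc n * Y)
  interleave = solve-∀
  regroup : ∀ N c → (N * c) * (N * c) ≡ N * (N * (c * c))
  regroup = solve-∀
  rotate : ∀ m n N T → N * (suc m * (suc n * T)) ≡ suc m * (suc n * (T * N))
  rotate = solve-∀

narayana : ∀ n m {T} → LGV T n n m m → T ≡ ((suc (n + m) C suc m) * (suc (n + m) C m)) / suc (n + m)
narayana n m {T} e = begin
  T                                          ≡⟨ m*n/n≡m T N ⟨
  T * N / N                                  ≡⟨ cong (_/ N) (narayana-product n m e) ⟨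
  paths n (suc m) * paths (suc n) m / N      ≡⟨ cong (_/ N) (cong₂ _*_ (paths≡C n (suc m)) (paths≡C (suc n) m)) ⟩
  ((n + suc m) C suc m) * (N C m) / N        ≡⟨ cong (λ k → (k C suc m) * (N C m) / N) (+-suc n m) ⟩
  (N C suc m) * (N C m) / N                  ∎
  where
  open ≡-Reasoning
  N = suc (n + m)

-- Pairs of non-crossing sequences

_≤²_ : ℕ × ℕ → ℕ × ℕ → Set
u ≤² u′ = proj₁ u ≤ proj₁ u′ × proj₂ u ≤ proj₂ u′

≤²-trans : ∀ {u u′ u″} → u ≤² u′ → u′ ≤² u″ → u ≤² u″
≤²-trans (p≤ , q≤) (p′≤ , q′≤) = ≤-trans p≤ p′≤ , ≤-trans q≤ q′≤

data NonCrossing : ℕ → ℕ → ∀ {n} → Vec (ℕ × ℕ) n → Set where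
  []   : ∀ {x y} → NonCrossing x y []
  step : ∀ {x y p q n} {v : Vec (ℕ × ℕ) n} →
         (p , q) ≤² (x , y) → q ≤ p → NonCrossing p q v → NonCrossing x y ((p , q) ∷ v)

nonCrossing-weaken : ∀ {x y x′ y′ n} {v : Vec (ℕ × ℕ) n} →
                     (x , y) ≤² (x′ , y′) → NonCrossing x y v → NonCrossing x′ y′ v
nonCrossing-weaken _       []                 = []
nonCrossing-weaken xy≤x′y′ (step pq≤xy q≤p v) = step (≤²-trans pq≤xy xy≤x′y′) q≤p v

nonCrossing-bounded : ∀ {x y n} {v : Vec (ℕ × ℕ) n} → NonCrossing x y v →
                      ∀ j → lookup v j ≤² (x , y)
nonCrossing-bounded (step u≤ _ _) zero    = u≤
nonCrossing-bounded (step u≤ _ v) (suc j) = ≤²-trans (nonCrossing-bounded v j) u≤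

nonCrossing-antitone : ∀ {x y n} {v : Vec (ℕ × ℕ) n} → NonCrossing x y v →
                       ∀ {j j′} → toℕ j ≤ toℕ j′ → lookup v j′ ≤² lookup v j
nonCrossing-antitone (step _ _ _) {zero}  {zero}   _          = ≤-refl , ≤-refl
nonCrossing-antitone (step _ _ v) {zero}  {suc j′} _          = nonCrossing-bounded v j′
nonCrossing-antitone (step _ _ v) {suc j} {suc j′} (s≤s j≤j′) = nonCrossing-antitone v j≤j′

nonCrossing-below : ∀ {x y n} {v : Vec (ℕ × ℕ) n} → NonCrossing x y v →
                    ∀ j → proj₂ (lookup v j) ≤ proj₁ (lookup v j)
nonCrossing-below (step _ q≤p _) zero    = q≤p
nonCrossing-below (step _ _   v) (suc j) = nonCrossing-below v j

tabulate-nonCrossing : ∀ {x y n} (g : Fin n → ℕ × ℕ) →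
                       (∀ j → g j ≤² (x , y)) → (∀ {j j′} → toℕ j ≤ toℕ j′ → g j′ ≤² g j) →
                       (∀ j → proj₂ (g j) ≤ proj₁ (g j)) → NonCrossing x y (tabulate g)
tabulate-nonCrossing {n = zero}  g bounded antitone below = []
tabulate-nonCrossing {n = suc n} g bounded antitone below =
  step (bounded zero) (below zero)
    (tabulate-nonCrossing (g ∘ suc) (λ j → antitone {zero} {suc j} z≤n) (antitone ∘ s≤s) (below ∘ suc))

-- For y ≤ x, split on the first pair: either p₁ ≤ x − 1, which caps q₁ ≤ p₁ by y ⊓ (x − 1),
-- or p₁ = x, and then startingAt splits on q₁.
mutual
  nonCrossing : (n x y : ℕ) → List (Vec (ℕ × ℕ) n)
  nonCrossing zero    x       y = [ [] ]
  nonCrossing (suc n) zero    y = startingAt n zero zero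
  nonCrossing (suc n) (suc x) y = nonCrossing (suc n) x (y ⊓ x) ++ startingAt n (suc x) y

  startingAt : (n x y : ℕ) → List (Vec (ℕ × ℕ) (suc n))
  startingAt n x zero    = map ((x , 0) ∷_) (nonCrossing n x 0)
  startingAt n x (suc y) = startingAt n x y ++ map ((x , suc y) ∷_) (nonCrossing n x (suc y))

mutual
  nonCrossing-sound : ∀ n x y {v} → y ≤ x → v ∈ nonCrossing n x y → NonCrossing x y v
  nonCrossing-sound zero    x       y _ (here refl) = []
  nonCrossing-sound (suc n) zero    y _ v∈ =
    nonCrossing-weaken (≤-refl , z≤n) (proj₁ (startingAt-sound n 0 0 z≤n v∈))
  nonCrossing-sound (suc n) (suc x) y y≤x v∈ with ∈-++⁻ (nonCrossing (suc n) x (y ⊓ x)) v∈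
  ... | inj₁ v∈₁ = nonCrossing-weaken (n≤1+n x , m⊓n≤m y x)
                     (nonCrossing-sound (suc n) x (y ⊓ x) (m⊓n≤n y x) v∈₁)
  ... | inj₂ v∈₂ = proj₁ (startingAt-sound n (suc x) y y≤x v∈₂)

  startingAt-sound : ∀ n x y {v} → y ≤ x → v ∈ startingAt n x y →
                     NonCrossing x y v × proj₁ (head v) ≡ x
  startingAt-sound n x zero    _ v∈ with ∈-map⁻ ((x , 0) ∷_) v∈
  ... | w , w∈ , refl = step (≤-refl , z≤n) z≤n (nonCrossing-sound n x 0 z≤n w∈) , refl
  startingAt-sound n x (suc y) y<x v∈ with ∈-++⁻ (startingAt n x y) v∈
  ... | inj₁ v∈₁ = map₁ (nonCrossing-weaken (≤-refl , n≤1+n y))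
                     (startingAt-sound n x y (<⇒≤ y<x) v∈₁)
  ... | inj₂ v∈₂ with ∈-map⁻ ((x , suc y) ∷_) v∈₂
  ...   | w , w∈ , refl = step (≤-refl , ≤-refl) y<x (nonCrossing-sound n x (suc y) y<x w∈) , refl

mutual
  nonCrossing-complete : ∀ n x y {v} → y ≤ x → NonCrossing x y v → v ∈ nonCrossing n x y
  nonCrossing-complete zero    x       y _ [] = here refl
  nonCrossing-complete (suc n) zero    y _ (step (z≤n , _) q≤p v) =
    startingAt-complete n 0 0 z≤n (step (z≤n , q≤p) q≤p v)
  nonCrossing-complete (suc n) (suc x) y y≤x nc@(step (p≤1+x , q≤y) q≤p v) with ≤-suc-cases p≤1+x
  ... | inj₁ p≤x  = ∈-++⁺ˡ (nonCrossing-complete (suc n) x (y ⊓ x) (m⊓n≤n y x)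
                             (step (p≤x , ⊓-glb q≤y (≤-trans q≤p p≤x)) q≤p v))
  ... | inj₂ refl = ∈-++⁺ʳ (nonCrossing (suc n) x (y ⊓ x)) (startingAt-complete n (suc x) y y≤x nc)

  startingAt-complete : ∀ n x y {q w} → y ≤ x → NonCrossing x y ((x , q) ∷ w) →
                        (x , q) ∷ w ∈ startingAt n x y
  startingAt-complete n x zero    _   (step (_ , z≤n) _ w) =
    ∈-map⁺ ((x , 0) ∷_) (nonCrossing-complete n x 0 z≤n w)
  startingAt-complete n x (suc y) y<x (step (x≤x , q≤1+y) q≤x w) with ≤-suc-cases q≤1+y
  ... | inj₁ q≤y  = ∈-++⁺ˡ (startingAt-complete n x y (<⇒≤ y<x) (step (x≤x , q≤y) q≤x w))
  ... | inj₂ refl = ∈-++⁺ʳ (startingAt n x y)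
                      (∈-map⁺ ((x , suc y) ∷_) (nonCrossing-complete n x (suc y) y<x w))

mutual
  nonCrossing-unique : ∀ n x y → y ≤ x → Unique (nonCrossing n x y)
  nonCrossing-unique zero    x       y _   = All.[] ∷ []
  nonCrossing-unique (suc n) zero    y _   = startingAt-unique n 0 0 z≤n
  nonCrossing-unique (suc n) (suc x) y y≤x = Unique.++⁺
    (nonCrossing-unique (suc n) x (y ⊓ x) (m⊓n≤n y x)) (startingAt-unique n (suc x) y y≤x) disjoint
    where
    disjoint : ∀ {v} → ¬ (v ∈ nonCrossing (suc n) x (y ⊓ x) × v ∈ startingAt n (suc x) y)
    disjoint (v∈₁ , v∈₂)
      with nonCrossing-sound (suc n) x (y ⊓ x) (m⊓n≤n y x) v∈₁ | startingAt-sound n (suc x) y y≤x v∈₂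
    ... | step (p≤x , _) _ _ | _ , refl = 1+n≰n p≤x

  startingAt-unique : ∀ n x y → y ≤ x → Unique (startingAt n x y)
  startingAt-unique n x zero    _   = Unique.map⁺ ∷-injectiveʳ (nonCrossing-unique n x 0 z≤n)
  startingAt-unique n x (suc y) y<x = Unique.++⁺
    (startingAt-unique n x y (<⇒≤ y<x))
    (Unique.map⁺ ∷-injectiveʳ (nonCrossing-unique n x (suc y) y<x)) disjoint
    where
    disjoint : ∀ {v} → ¬ (v ∈ startingAt n x y × v ∈ map ((x , suc y) ∷_) (nonCrossing n x (suc y)))
    disjoint (v∈₁ , v∈₂) with startingAt-sound n x y (<⇒≤ y<x) v∈₁ | ∈-map⁻ ((x , suc y) ∷_) v∈₂
    ... | step (_ , q≤y) _ _ , _ | _ , _ , refl = 1+n≰n q≤y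

mutual
  length-nonCrossing : ∀ n x y → y ≤ x → LGV (length (nonCrossing n x y)) n n x y
  length-nonCrossing zero    x       y  _   = cong suc (*-zeroʳ (paths⁺ 0 y))
  length-nonCrossing (suc n) zero    .0 z≤n =
    subst (λ c → length (startingAt n 0 0) + 0 ≡ c * 1) (paths-zeroʳ n) (length-startingAt n 0 0 z≤n)
  length-nonCrossing (suc n) (suc x) y  y≤x =
    subst (λ L → LGV L (suc n) (suc n) (suc x) y) (sym (length-++ (nonCrossing (suc n) x (y ⊓ x))))
      (lgv-stepˡ n (suc n) x y
        (lgv-clamp (suc n) x y y≤x (length-nonCrossing (suc n) x (y ⊓ x) (m⊓n≤n y x)))
        (length-startingAt n (suc x) y y≤x))

  length-startingAt : ∀ n x y → y ≤ x → LGV (length (startingAt n x y)) n (suc n) x y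
  length-startingAt n x zero    _   =
    subst₂ (λ L c → L + 0 ≡ paths n x * c) (sym (length-map ((x , 0) ∷_) (nonCrossing n x 0)))
      (paths-zeroʳ n) (length-nonCrossing n x 0 z≤n)
  length-startingAt n x (suc y) y<x =
    subst (λ L → LGV L n (suc n) x (suc y)) (sym length-split)
      (lgv-stepʳ n n x y (length-startingAt n x y (<⇒≤ y<x)) (length-nonCrossing n x (suc y) y<x))
    where
    length-split : length (startingAt n x (suc y))
                 ≡ length (startingAt n x y) + length (nonCrossing n x (suc y))
    length-split = trans (length-++ (startingAt n x y))
      (cong (length (startingAt n x y) +_) (length-map ((x , suc y) ∷_) (nonCrossing n x (suc y))))

-- Mergings given by thresholds

leadingTrues : ∀ {k} → Vec Bool k → ℕ
leadingTrues []          = 0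
leadingTrues (true  ∷ w) = suc (leadingTrues w)
leadingTrues (false ∷ w) = 0

leadingFalses : ∀ {k} → Vec Bool k → ℕ
leadingFalses []          = 0
leadingFalses (false ∷ w) = suc (leadingFalses w)
leadingFalses (true  ∷ w) = 0

leadingTrues≤ : ∀ {k} (w : Vec Bool k) → leadingTrues w ≤ k
leadingTrues≤ []          = z≤n
leadingTrues≤ (true  ∷ w) = s≤s (leadingTrues≤ w)
leadingTrues≤ (false ∷ w) = z≤n

leadingFalses≤ : ∀ {k} (w : Vec Bool k) → leadingFalses w ≤ k
leadingFalses≤ []          = z≤n
leadingFalses≤ (false ∷ w) = s≤s (leadingFalses≤ w)
leadingFalses≤ (true  ∷ w) = z≤n

DownClosed : ∀ {k} → Vec Bool k → Set
DownClosed w = ∀ {i i′} → toℕ i′ ≤ toℕ i → lookup w i ≡ true → lookup w i′ ≡ true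

UpClosed : ∀ {k} → Vec Bool k → Set
UpClosed w = ∀ {i i′} → toℕ i ≤ toℕ i′ → lookup w i ≡ true → lookup w i′ ≡ true

leadingTrues-lookup : ∀ {k} (w : Vec Bool k) i → toℕ i < leadingTrues w → lookup w i ≡ true
leadingTrues-lookup (true ∷ w) zero    _         = refl
leadingTrues-lookup (true ∷ w) (suc i) (s≤s i<ℓ) = leadingTrues-lookup w i i<ℓ

lookup-leadingTrues : ∀ {k} (w : Vec Bool k) → DownClosed w →
                      ∀ i → lookup w i ≡ true → toℕ i < leadingTrues w
lookup-leadingTrues (true  ∷ w) closed zero    _ = s≤s z≤n
lookup-leadingTrues (true  ∷ w) closed (suc i) t = s≤s (lookup-leadingTrues w (closed ∘ s≤s) i t)
lookup-leadingTrues (false ∷ w) closed i       t with closed {i} {zero} z≤n t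
... | ()

lookup-leadingFalses : ∀ {k} (w : Vec Bool k) i → lookup w i ≡ true → leadingFalses w ≤ toℕ i
lookup-leadingFalses (true  ∷ w) i       _ = z≤n
lookup-leadingFalses (false ∷ w) (suc i) t = s≤s (lookup-leadingFalses w i t)

leadingFalses-lookup : ∀ {k} (w : Vec Bool k) → UpClosed w →
                       ∀ i → leadingFalses w ≤ toℕ i → lookup w i ≡ true
leadingFalses-lookup (true  ∷ w) closed i       _         = closed {zero} {i} z≤n refl
leadingFalses-lookup (false ∷ w) closed (suc i) (s≤s f≤i) = leadingFalses-lookup w (closed ∘ s≤s) i f≤i

≤-viaLowerCuts : ∀ {m a b} → b ≤ m → (∀ (i : Fin m) → toℕ i < b → toℕ i < a) → b ≤ a
≤-viaLowerCuts b≤m below = ≮⇒≥ λ a<b →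
  <-irrefl (toℕ-fromℕ< _)
    (below (fromℕ< (<-≤-trans a<b b≤m)) (subst (_< _) (sym (toℕ-fromℕ< _)) a<b))

≤-viaUpperCuts : ∀ {m a b} → b ≤ m → (∀ (i : Fin m) → a ≤ toℕ i → b ≤ toℕ i) → b ≤ a
≤-viaUpperCuts b≤m above = ≮⇒≥ λ a<b →
  <⇒≱ (subst (_< _) (sym (toℕ-fromℕ< _)) a<b)
      (above (fromℕ< (<-≤-trans a<b b≤m)) (≤-reflexive (sym (toℕ-fromℕ< _))))

<ᵇ-true⇔< : ∀ {a b} → (a <ᵇ b) ≡ true ⇔ a < b
<ᵇ-true⇔< {a} {b} = mk⇔ (<ᵇ⇒< a b ∘ from T-≡) (to T-≡ ∘ <⇒<ᵇ)

≤ᵇ-true⇔≤ : ∀ {a b} → (a ≤ᵇ b) ≡ true ⇔ a ≤ b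
≤ᵇ-true⇔≤ {a} {b} = mk⇔ (≤ᵇ⇒≤ a b ∘ from T-≡) (to T-≡ ∘ ≤⇒≤ᵇ)

record Thresholds {m n} (R : BRel m n) (S : BRel n m) (ℓ f : Fin n → ℕ) : Set where
  field
    R⇔< : ∀ i j → R ∋⟨ i , j ⟩ ⇔ toℕ i < ℓ j
    S⇔≥ : ∀ j i → S ∋⟨ j , i ⟩ ⇔ f j ≤ toℕ i

record Admissible {n} (m : ℕ) (ℓ f : Fin n → ℕ) : Set where
  field
    ℓ-mono : ∀ {j j′} → toℕ j ≤ toℕ j′ → ℓ j ≤ ℓ j′
    f-mono : ∀ {j j′} → toℕ j ≤ toℕ j′ → f j ≤ f j′
    ℓ≤f    : ∀ j → ℓ j ≤ f j
    f≤m    : ∀ j → f j ≤ m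

open Thresholds
open Admissible

thresholdMerging : ∀ {n} m → (Fin n → ℕ) → (Fin n → ℕ) → BRel m n × BRel n m
thresholdMerging m ℓ f = tabulate (λ i → tabulate (λ j → toℕ i <ᵇ ℓ j))
                       , tabulate (λ j → tabulate (λ i → f j ≤ᵇ toℕ i))

lookup∘tabulate² : ∀ {A : Set} {k l} (g : Fin k → Fin l → A) i j →
                   lookup (lookup (tabulate (λ i → tabulate (g i))) i) j ≡ g i j
lookup∘tabulate² g i j =
  trans (cong (λ row → lookup row j) (lookup∘tabulate _ i)) (lookup∘tabulate (g i) j)

lookup²-ext : ∀ {A : Set} {k l} {M M′ : Vec (Vec A l) k} →
              (∀ i j → lookup (lookup M i) j ≡ lookup (lookup M′ i) j) → M ≡ M′
lookup²-ext eq = Pointwise-≡⇒≡ (ext λ i → Pointwise-≡⇒≡ (ext (eq i)))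

thresholdMerging-thresholds : ∀ {n} m (ℓ f : Fin n → ℕ) →
  Thresholds (proj₁ (thresholdMerging m ℓ f)) (proj₂ (thresholdMerging m ℓ f)) ℓ f
thresholdMerging-thresholds m ℓ f = record
  { R⇔< = λ i j → subst (λ b → b ≡ true ⇔ _)
                    (sym (lookup∘tabulate² (λ i j → toℕ i <ᵇ ℓ j) i j)) <ᵇ-true⇔<
  ; S⇔≥ = λ j i → subst (λ b → b ≡ true ⇔ _)
                    (sym (lookup∘tabulate² (λ j i → f j ≤ᵇ toℕ i) j i)) ≤ᵇ-true⇔≤
  }

thresholdMerging-cong : ∀ {n} m {ℓ ℓ′ f f′ : Fin n → ℕ} →
                        (∀ j → ℓ j ≡ ℓ′ j) → (∀ j → f j ≡ f′ j) → thresholdMerging m ℓ f ≡ thresholdMerging m ℓ′ f′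
thresholdMerging-cong m ℓ≗ℓ′ f≗f′ = cong₂ _,_
  (tabulate-cong λ i → tabulate-cong λ j → cong (toℕ i <ᵇ_) (ℓ≗ℓ′ j))
  (tabulate-cong λ j → tabulate-cong λ i → cong (_≤ᵇ toℕ i) (f≗f′ j))

thresholds-determine : ∀ {m n} {R : BRel m n} {S : BRel n m} {ℓ f} →
                       Thresholds R S ℓ f → thresholdMerging m ℓ f ≡ (R , S)
thresholds-determine {m} {ℓ = ℓ} {f} th = cong₂ _,_
  (lookup²-ext λ i j → ⇔→≡ (⇔.trans (R⇔< th₀ i j) (⇔.sym (R⇔< th i j))))
  (lookup²-ext λ j i → ⇔→≡ (⇔.trans (S⇔≥ th₀ j i) (⇔.sym (S⇔≥ th j i))))
  where th₀ = thresholdMerging-thresholds m ℓ f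

thresholds-≤ : ∀ {m n} {R : BRel m n} {S : BRel n m} {ℓ f ℓ′ f′} →
               Thresholds R S ℓ f → Admissible m ℓ f → Thresholds R S ℓ′ f′ →
               ∀ j → ℓ j ≤ ℓ′ j × f j ≤ f′ j
thresholds-≤ th adm th′ j =
    ≤-viaLowerCuts (≤-trans (ℓ≤f adm j) (f≤m adm j))
      (λ i i<ℓ → to (R⇔< th′ i j) (from (R⇔< th i j) i<ℓ))
  , ≤-viaUpperCuts (f≤m adm j)
      (λ i f′≤i → to (S⇔≥ th j i) (from (S⇔≥ th′ j i) f′≤i))

thresholds-unique : ∀ {m n} {R : BRel m n} {S : BRel n m} {ℓ f ℓ′ f′} →
                    Thresholds R S ℓ f → Admissible m ℓ f →
                    Thresholds R S ℓ′ f′ → Admissible m ℓ′ f′ → ∀ j → ℓ j ≡ ℓ′ j × f j ≡ f′ j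
thresholds-unique th adm th′ adm′ j with thresholds-≤ th adm th′ j | thresholds-≤ th′ adm′ th j
... | ℓ≤ℓ′ , f≤f′ | ℓ′≤ℓ , f′≤f = ≤-antisym ℓ≤ℓ′ ℓ′≤ℓ , ≤-antisym f≤f′ f′≤f

module _ {m n} {R : BRel m n} {S : BRel n m} {ℓ f}
         (th : Thresholds R S ℓ f) (adm : Admissible m ℓ f) where

  private
    R∧S⇒< : ∀ {i j i′} → R ∋⟨ i , j ⟩ → S ∋⟨ j , i′ ⟩ → toℕ i < toℕ i′
    R∧S⇒< {i} {j} {i′} r s = <-≤-trans (to (R⇔< th i j) r) (≤-trans (ℓ≤f adm j) (to (S⇔≥ th j i′) s))

    R-mono : ∀ {i j j′} → R ∋⟨ i , j ⟩ → toℕ j ≤ toℕ j′ → R ∋⟨ i , j′ ⟩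
    R-mono {i} {j} {j′} r j≤j′ = from (R⇔< th i j′) (<-≤-trans (to (R⇔< th i j) r) (ℓ-mono adm j≤j′))

    merged-refl : ∀ x → merged R S x x
    merged-refl (inj₁ i) = ≤-refl
    merged-refl (inj₂ j) = ≤-refl

    merged-trans : Transitive (merged R S)
    merged-trans {inj₁ i} {inj₁ i′} {inj₁ i″} i≤i′ i′≤i″ = ≤-trans i≤i′ i′≤i″
    merged-trans {inj₂ j} {inj₂ j′} {inj₂ j″} j≤j′ j′≤j″ = ≤-trans j≤j′ j′≤j″
    merged-trans {inj₁ i} {inj₁ i′} {inj₂ j}  i≤i′ r =
      from (R⇔< th i j) (≤-<-trans i≤i′ (to (R⇔< th i′ j) r))
    merged-trans {inj₁ i} {inj₂ j}  {inj₂ j′} r j≤j′ = R-mono r j≤j′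
    merged-trans {inj₂ j} {inj₂ j′} {inj₁ i}  j≤j′ s =
      from (S⇔≥ th j i) (≤-trans (f-mono adm j≤j′) (to (S⇔≥ th j′ i) s))
    merged-trans {inj₂ j} {inj₁ i}  {inj₁ i′} s i≤i′ =
      from (S⇔≥ th j i′) (≤-trans (to (S⇔≥ th j i) s) i≤i′)
    merged-trans {inj₁ i} {inj₂ j}  {inj₁ i′} r s = <⇒≤ (R∧S⇒< r s)
    merged-trans {inj₂ j} {inj₁ i}  {inj₂ j′} s r =
      ≮⇒≥ λ j′<j → <-irrefl refl (R∧S⇒< (R-mono r (<⇒≤ j′<j)) s)

  thresholds-proper : IsProperMerging R S
  thresholds-proper = ((λ {x} → merged-refl x) , merged-trans) , λ i j (r , s) → <-irrefl refl (R∧S⇒< r s)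

column : ∀ {m n} → BRel m n → Fin n → Vec Bool m
column R j = Vec.map (λ row → lookup row j) R

lowerCut : ∀ {m n} → BRel m n → Fin n → ℕ
lowerCut R j = leadingTrues (column R j)

upperCut : ∀ {m n} → BRel n m → Fin n → ℕ
upperCut S j = leadingFalses (lookup S j)

module _ {m n} {R : BRel m n} {S : BRel n m} (P : IsProperMerging R S) where

  private
    merged-trans : Transitive (merged R S)
    merged-trans = proj₂ (proj₁ P)

    column-lookup : ∀ i j → lookup (column R j) i ≡ lookup (lookup R i) j
    column-lookup i j = lookup-map i (λ row → lookup row j) R

    column-closed : ∀ j → DownClosed (column R j)
    column-closed j {i} {i′} i′≤i t = trans (column-lookup i′ j)
      (merged-trans {inj₁ i′} {inj₁ i} {inj₂ j} i′≤i (trans (sym (column-lookup i j)) t))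

    row-closed : ∀ j → UpClosed (lookup S j)
    row-closed j {i} {i′} i≤i′ s = merged-trans {inj₂ j} {inj₁ i} {inj₁ i′} s i≤i′

  proper-thresholds : Thresholds R S (lowerCut R) (upperCut S)
  proper-thresholds = record
    { R⇔< = λ i j → subst (λ b → b ≡ true ⇔ toℕ i < lowerCut R j) (column-lookup i j)
                      (mk⇔ (lookup-leadingTrues (column R j) (column-closed j) i)
                           (leadingTrues-lookup (column R j) i))
    ; S⇔≥ = λ j i → mk⇔ (lookup-leadingFalses (lookup S j) i)
                         (leadingFalses-lookup (lookup S j) (row-closed j) i)
    }

  proper-admissible : Admissible m (lowerCut R) (upperCut S)
  proper-admissible = record
    { ℓ-mono = λ {j} {j′} j≤j′ → ≤-viaLowerCuts (leadingTrues≤ _) λ i i<ℓ →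
        to (R⇔< th i j′) (merged-trans {inj₁ i} {inj₂ j} {inj₂ j′} (from (R⇔< th i j) i<ℓ) j≤j′)
    ; f-mono = λ {j} {j′} j≤j′ → ≤-viaUpperCuts (leadingFalses≤ _) λ i f′≤i →
        to (S⇔≥ th j i) (merged-trans {inj₂ j} {inj₂ j′} {inj₁ i} j≤j′ (from (S⇔≥ th j′ i) f′≤i))
    ; ℓ≤f = λ j → ≤-viaUpperCuts (leadingTrues≤ _) λ i f≤i → ≮⇒≥ λ i<ℓ →
        proj₂ P i j (from (R⇔< th i j) i<ℓ , from (S⇔≥ th j i) f≤i)
    ; f≤m = λ j → leadingFalses≤ _
    }
    where th = proper-thresholds

-- Proper mergings as pairs of non-crossing sequences

-- Reflecting (pⱼ , qⱼ) = (m ∸ ℓⱼ , m ∸ fⱼ) turns the increasing thresholds of a merging into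
-- the decreasing sequences enumerated by nonCrossing.
encode : ∀ {n} m → Vec (ℕ × ℕ) n → BRel m n × BRel n m
encode m v = thresholdMerging m (λ j → m ∸ proj₁ (lookup v j)) (λ j → m ∸ proj₂ (lookup v j))

decode : ∀ {m n} → BRel m n × BRel n m → Vec (ℕ × ℕ) n
decode {m} x = tabulate λ j → m ∸ lowerCut (proj₁ x) j , m ∸ upperCut (proj₂ x) j

nonCrossing-admissible : ∀ {m n} {v : Vec (ℕ × ℕ) n} → NonCrossing m m v →
                         Admissible m (λ j → m ∸ proj₁ (lookup v j)) (λ j → m ∸ proj₂ (lookup v j))
nonCrossing-admissible {m} {v = v} nc = record
  { ℓ-mono = λ j≤j′ → ∸-monoʳ-≤ m (proj₁ (nonCrossing-antitone nc j≤j′))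
  ; f-mono = λ j≤j′ → ∸-monoʳ-≤ m (proj₂ (nonCrossing-antitone nc j≤j′))
  ; ℓ≤f    = λ j → ∸-monoʳ-≤ m (nonCrossing-below nc j)
  ; f≤m    = λ j → m∸n≤m m (proj₂ (lookup v j))
  }

encode-proper : ∀ {m n} {v : Vec (ℕ × ℕ) n} → NonCrossing m m v →
                IsProperMerging (proj₁ (encode m v)) (proj₂ (encode m v))
encode-proper {m} nc = thresholds-proper (thresholdMerging-thresholds m _ _) (nonCrossing-admissible nc)

decode-encode : ∀ {m n} {v : Vec (ℕ × ℕ) n} → NonCrossing m m v → decode (encode m v) ≡ v
decode-encode {m} {v = v} nc = Pointwise-≡⇒≡ (ext λ j → trans (lookup∘tabulate _ j)
  (cong₂ _,_ (reflect (proj₁ (cuts j)) (p≤m j)) (reflect (proj₂ (cuts j)) (q≤m j))))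
  where
  P = encode-proper nc
  cuts = thresholds-unique (proper-thresholds P) (proper-admissible P)
                           (thresholdMerging-thresholds m _ _) (nonCrossing-admissible nc)
  p≤m : ∀ j → proj₁ (lookup v j) ≤ m
  p≤m j = proj₁ (nonCrossing-bounded nc j)
  q≤m : ∀ j → proj₂ (lookup v j) ≤ m
  q≤m j = ≤-trans (nonCrossing-below nc j) (p≤m j)
  reflect : ∀ {c a} → c ≡ m ∸ a → a ≤ m → m ∸ c ≡ a
  reflect refl a≤m = m∸[m∸n]≡n a≤m

encode-decode : ∀ {m n} {R : BRel m n} {S : BRel n m} → IsProperMerging R S →
                encode m (decode (R , S)) ≡ (R , S)
encode-decode {m} {R = R} P = trans
  (thresholdMerging-cong m
    (λ j → trans (cong (λ u → m ∸ proj₁ u) (lookup∘tabulate _ j)) (m∸[m∸n]≡n (ℓ≤m j)))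
    (λ j → trans (cong (λ u → m ∸ proj₂ u) (lookup∘tabulate _ j)) (m∸[m∸n]≡n (f≤m adm j))))
  (thresholds-determine (proper-thresholds P))
  where
  adm = proper-admissible P
  ℓ≤m : ∀ j → lowerCut R j ≤ m
  ℓ≤m j = ≤-trans (ℓ≤f adm j) (f≤m adm j)

decode-nonCrossing : ∀ {m n} {R : BRel m n} {S : BRel n m} → IsProperMerging R S →
                     NonCrossing m m (decode (R , S))
decode-nonCrossing {m} {R = R} {S} P = tabulate-nonCrossing _
  (λ j → m∸n≤m m (lowerCut R j) , m∸n≤m m (upperCut S j))
  (λ j≤j′ → ∸-monoʳ-≤ m (ℓ-mono adm j≤j′) , ∸-monoʳ-≤ m (f-mono adm j≤j′))
  (λ j → ∸-monoʳ-≤ m (ℓ≤f adm j))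
  where adm = proper-admissible P

properMergings : ∀ m n → List (BRel m n × BRel n m)
properMergings m n = map (encode m) (nonCrossing n m m)

∈-properMergings : ∀ m n (x : BRel m n × BRel n m) →
                   x ∈ properMergings m n ⇔ IsProperMerging (proj₁ x) (proj₂ x)
∈-properMergings m n x = mk⇔ sound complete
  where
  sound : x ∈ properMergings m n → IsProperMerging (proj₁ x) (proj₂ x)
  sound x∈ with ∈-map⁻ (encode m) x∈
  ... | v , v∈ , refl = encode-proper (nonCrossing-sound n m m ≤-refl v∈)
  complete : IsProperMerging (proj₁ x) (proj₂ x) → x ∈ properMergings m n
  complete P = subst (_∈ properMergings m n) (encode-decode P)
    (∈-map⁺ (encode m) (nonCrossing-complete n m m ≤-refl (decode-nonCrossing P)))

properMergings-unique : ∀ m n → Unique (properMergings m n)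
properMergings-unique m n = Unique.map⁻ {f = decode}
  (subst Unique (trans (sym decode∘encode≡id) (map-∘ {g = decode} {f = encode m} candidates))
    (nonCrossing-unique n m m ≤-refl))
  where
  candidates = nonCrossing n m m
  decode∘encode≡id : map (decode ∘ encode m) candidates ≡ candidates
  decode∘encode≡id = map-id-local (All.tabulate λ v∈ → decode-encode (nonCrossing-sound n m m ≤-refl v∈))

length-properMergings : ∀ m n →
  length (properMergings m n) ≡ ((suc (n + m) C suc m) * (suc (n + m) C m)) / suc (n + m)
length-properMergings m n =
  trans (length-map (encode m) (nonCrossing n m m)) (narayana n m (length-nonCrossing n m m ≤-refl))

theorem3p1 : (m n : ℕ) →
    Σ (List (BRel m n × BRel n m)) λ L →
      Unique L
      × ((x : BRel m n × BRel n m) → (x ∈ L) ⇔ IsProperMerging (proj₁ x) (proj₂ x))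
      × length L ≡ ((suc (n + m) C suc m) * (suc (n + m) C m)) / suc (n + m)
theorem3p1 m n = properMergings m n , properMergings-unique m n , ∈-properMergings m n , length-properMergings m n
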